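{- Let $\gamma,\delta$ be constants (e.g. integers) and let the formal power series expansion of $$ \prod_{k\ge0}\left(1+\gamma x^{2^k-1}+\delta x^{2^k}\right) $$ be $a(0)+a(1)x+a(2)x^2+\cdots$. Then for all $n\ge0$, $$ a(n)=\sum_{m\ge0}\gamma^m\delta^{\mathrm{wt}(n+m)-m}\binom{\mathrm{wt}(n+m)}{m}. $$
   Context: $\mathrm{wt}(n)$ denotes the binary weight of $n$, i.e. the number of $1$'s in the binary expansion of $n$. The binomial coefficient $\binom{w}{m}$ is $0$ for $m>w$, so the sum has only finitely many nonzero terms. Note that the $k=0$ factor of the product is $1+\gamma+\delta x$. -}

module Defs where

open import Level using (Level)
open import Data.Nat as ℕ using (ℕ; zero; suc; _∸_; _≡ᵇ_)
open import Data.Nat.DivMod using (_/_; _%_)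
open import Data.Bool using (if_then_else_)
open import Algebra.Bundles using (CommutativeRing; Semiring)
open import Data.Nat.Combinatorics using (_C_)
import Algebra.Definitions.RawSemiring as RS

-- Binary weight wt(n): number of 1's in the binary expansion of n.
-- Computed with fuel n (n halves to 0 in at most n steps, so fuel n suffices).
wtAux : ℕ → ℕ → ℕ
wtAux zero    n = 0
wtAux (suc f) n = n % 2 ℕ.+ wtAux f (n / 2)

wt : ℕ → ℕ
wt n = wtAux n n

module _ {c ℓ : Level} (R : CommutativeRing c ℓ) where
  open CommutativeRing R
  open RS (Semiring.rawSemiring semiring) using (_×_; _^_)

  Series : Set c
  Series = ℕ → Carrier

  sumBelow : ℕ → (ℕ → Carrier) → Carrier
  sumBelow zero    f = 0#
  sumBelow (suc n) f = sumBelow n f + f n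

  _⊛_ : Series → Series → Series
  (f ⊛ g) n = sumBelow (suc n) (λ i → f i * g (n ∸ i))

  oneS : Series
  oneS zero    = 1#
  oneS (suc _) = 0#

  -- coefficient sequence of 1 + γ x^(2^k - 1) + δ x^(2^k)
  -- (for k = 0 this is 1 + γ + δ x)
  factor : Carrier → Carrier → ℕ → Series
  factor γ δ k j =
    oneS j
    + (if j ≡ᵇ (2 ℕ.^ k ∸ 1) then γ else 0#)
    + (if j ≡ᵇ (2 ℕ.^ k) then δ else 0#)

  partialProd : Carrier → Carrier → ℕ → Series
  partialProd γ δ zero    = oneS
  partialProd γ δ (suc N) = partialProd γ δ N ⊛ factor γ δ N

  -- a(n): coefficient of x^n in the infinite product.  For k > n the factor
  -- is 1 + O(x^(n+1)), so the coefficient of x^n is already determined by the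
  -- factors k = 0 .. n.
  a : Carrier → Carrier → ℕ → Carrier
  a γ δ n = partialProd γ δ (suc n) n

  term : Carrier → Carrier → ℕ → ℕ → Carrier
  term γ δ n m =
    (γ ^ m) * (δ ^ (wt (n ℕ.+ m) ∸ m)) * ((wt (n ℕ.+ m) C m) × 1#)

module Submission where

-- Write the k-th factor as  1 + x^(2^k) (δ + γ x⁻¹).  Expanding
-- the product of the first K factors, a choice of one summand from each factor
-- is the same as a number N < 2^K (its binary digits say which factors
-- contribute the second summand), and that choice contributes the "monomial"
--     x^N (δ + γ x⁻¹)^wt(N).
-- Hence the K-th partial product is  Σ_{N < 2^K} x^N (δ + γ x⁻¹)^wt(N)
-- (lemma `expansion`, by induction on K: the new factor maps the monomial of N
-- to itself plus the monomial of 2^K + N, since wt(2^K + N) = 1 + wt(N)).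
-- By the binomial theorem the coefficient of x^n in the monomial of N = n + m
-- is  γ^m δ^(wt N - m) binom(wt N, m),  the m-th summand of the theorem, and it
-- vanishes for m ≥ n + 2 because 2 wt(N) ≤ N + 1.

open import Level using (Level)
open import Data.Nat as ℕ using (ℕ; zero; suc; _∸_; _≤_; s≤s; _≡ᵇ_)
import Data.Nat.Properties as ℕP
open import Data.Nat.Combinatorics using (_C_; k>n⇒nCk≡0; nCk+nC[k+1]≡[n+1]C[k+1])
open import Data.Bool using (true; false; if_then_else_; T)
open import Data.Unit using (tt)
open import Data.Product using (_,_)
open import Data.Empty using (⊥-elim)
open import Relation.Nullary using (yes; no)
open import Relation.Binary.PropositionalEquality as Eq using (_≡_; _≢_; cong)
open import Algebra.Bundles using (CommutativeRing; Semiring)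
import Algebra.Definitions.RawSemiring as RawSemiringDefs
import Algebra.Properties.Semiring.Mult as SemiringMult
import Relation.Binary.Reasoning.Setoid as SetoidReasoning
import Algebra.Solver.Ring.NaturalCoefficients.Default as RingSolver
open import Defs

module BinaryWeight where
  open import Data.Nat
  open import Data.Nat.Properties
  open import Data.Nat.DivMod
  open import Data.Nat.Divisibility using (n∣m*n)
  open import Data.Nat.Induction using (<-rec)
  open import Relation.Nullary using (¬_)
  open import Relation.Binary.PropositionalEquality

  half< : ∀ k → suc k / 2 < suc k
  half< k = m/n<m (suc k) 2 (s≤s (s≤s z≤n))

  wtAux-zero : ∀ f → wtAux f 0 ≡ 0
  wtAux-zero zero    = refl
  wtAux-zero (suc f) = wtAux-zero f

  -- Any fuel at least N gives the same result: N is halved to 0 in ≤ N steps.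
  wtAux-fuel : ∀ f g N → N ≤ f → N ≤ g → wtAux f N ≡ wtAux g N
  wtAux-fuel f g zero _ _ = trans (wtAux-zero f) (sym (wtAux-zero g))
  wtAux-fuel (suc f) (suc g) N@(suc k) (s≤s k≤f) (s≤s k≤g) =
    cong (N % 2 +_) (wtAux-fuel f g (N / 2) (half≤ k≤f) (half≤ k≤g))
    where
      half≤ : ∀ {h} → k ≤ h → N / 2 ≤ h
      half≤ k≤h = ≤-trans (≤-pred (half< k)) k≤h

  wt-halve : ∀ N → wt N ≡ N % 2 + wt (N / 2)
  wt-halve zero    = refl
  wt-halve (suc k) =
    cong (suc k % 2 +_) (wtAux-fuel k (suc k / 2) (suc k / 2) (≤-pred (half< k)) ≤-refl)

  -- Each binary digit is worth at least one, so wt N ≤ N.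
  wt-≤ : ∀ N → wt N ≤ N
  wt-≤ = <-rec _ bound
    where
      bound : ∀ N → (∀ {M} → M < N → wt M ≤ M) → wt N ≤ N
      bound zero    _   = z≤n
      bound N@(suc k) rec = begin
        wt N              ≡⟨ wt-halve N ⟩
        N % 2 + wt q      ≤⟨ +-monoʳ-≤ (N % 2) (rec (half< k)) ⟩
        N % 2 + q         ≤⟨ +-monoʳ-≤ (N % 2) (m≤m*n q 2) ⟩
        N % 2 + q * 2     ≡⟨ m≡m%n+[m/n]*n N 2 ⟨
        N                 ∎
        where
          q = N / 2
          open ≤-Reasoning

  -- The sharper bound  2 wt(N) ≤ N + 1.  Writing N = r + 2q with r ∈ {0, 1},
  -- the case r = 0 follows from the bound for q, the case r = 1 from wt q ≤ q.
  wt-double-bound : ∀ N → wt N + wt N ≤ suc N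
  wt-double-bound = <-rec _ bound
    where
      digit-step : ∀ r q → r < 2 → wt q + wt q ≤ suc q →
                   (r + wt q) + (r + wt q) ≤ suc (r + q * 2)
      digit-step 0 q _ ih = ≤-trans ih (s≤s (m≤m*n q 2))
      digit-step 1 q _ _  = begin
        suc (wt q + suc (wt q))  ≡⟨ cong suc (+-suc (wt q) (wt q)) ⟩
        suc (suc (wt q + wt q))  ≤⟨ s≤s (s≤s (+-mono-≤ (wt-≤ q) (wt-≤ q))) ⟩
        suc (suc (q + q))        ≡⟨ cong (λ x → suc (suc (q + x))) (+-identityʳ q) ⟨
        suc (suc (2 * q))        ≡⟨ cong (λ x → suc (suc x)) (*-comm 2 q) ⟩
        suc (suc (q * 2))        ∎
        where open ≤-Reasoning
      digit-step (suc (suc _)) _ (s≤s (s≤s ())) _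

      bound : ∀ N → (∀ {M} → M < N → wt M + wt M ≤ suc M) → wt N + wt N ≤ suc N
      bound zero _ = z≤n
      bound N@(suc k) rec = begin
        wt N + wt N                          ≡⟨ cong₂ _+_ (wt-halve N) (wt-halve N) ⟩
        (N % 2 + wt q) + (N % 2 + wt q)      ≤⟨ digit-step (N % 2) q (m%n<n N 2) (rec (half< k)) ⟩
        suc (N % 2 + q * 2)                  ≡⟨ cong suc (m≡m%n+[m/n]*n N 2) ⟨
        suc N                                ∎
        where
          q = N / 2
          open ≤-Reasoning

  wt-small : ∀ n m → suc (suc n) ≤ m → wt (n + m) < m
  wt-small n m 2+n≤m = ≰⇒> m≰wt
    where
      m≰wt : ¬ (m ≤ wt (n + m))
      m≰wt m≤wt = <⇒≱ (≤-<-trans (wt-double-bound (n + m)) (+-monoˡ-≤ m 2+n≤m))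
                      (+-mono-≤ m≤wt m≤wt)

  -- For N < 2^K, adding 2^K sets a new leading binary digit: the weight grows by one.
  wt-2^K+ : ∀ K N → N < 2 ^ K → wt (2 ^ K + N) ≡ suc (wt N)
  wt-2^K+ zero    zero    _           = refl
  wt-2^K+ zero    (suc _) (s≤s ())
  wt-2^K+ (suc K) N N<2^[1+K] = begin
    wt (2 ^ suc K + N)                              ≡⟨ cong wt as-digits ⟩
    wt (N + 2 ^ K * 2)                              ≡⟨ wt-halve (N + 2 ^ K * 2) ⟩
    (N + 2 ^ K * 2) % 2 + wt ((N + 2 ^ K * 2) / 2)  ≡⟨ cong₂ _+_ ([m+kn]%n≡m%n N (2 ^ K) 2) (cong wt halved) ⟩
    N % 2 + wt (2 ^ K + N / 2)                      ≡⟨ cong (N % 2 +_) (wt-2^K+ K (N / 2) (m<n*o⇒m/o<n N<2^K*2)) ⟩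
    N % 2 + suc (wt (N / 2))                        ≡⟨ +-suc (N % 2) (wt (N / 2)) ⟩
    suc (N % 2 + wt (N / 2))                        ≡⟨ cong suc (wt-halve N) ⟨
    suc (wt N)                                      ∎
    where
      open ≡-Reasoning
      as-digits : 2 ^ suc K + N ≡ N + 2 ^ K * 2
      as-digits = trans (+-comm (2 ^ suc K) N) (cong (N +_) (*-comm 2 (2 ^ K)))
      halved : (N + 2 ^ K * 2) / 2 ≡ 2 ^ K + N / 2
      halved = trans (+-distrib-/-∣ʳ N (n∣m*n (2 ^ K)))
                     (trans (cong (N / 2 +_) (m*n/n≡m (2 ^ K) 2)) (+-comm (N / 2) (2 ^ K)))
      N<2^K*2 : N < 2 ^ K * 2
      N<2^K*2 = subst (N <_) (*-comm 2 (2 ^ K)) N<2^[1+K]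

  suc-≤-2^ : ∀ n → suc n ≤ 2 ^ n
  suc-≤-2^ zero    = s≤s z≤n
  suc-≤-2^ (suc n) = +-mono-≤ (m^n>0 2 n) (≤-trans (suc-≤-2^ n) (m≤m+n (2 ^ n) 0))

  -- The range N < 2^(n+1) covers n + m for all m ≤ n + 1.
  2^[1+n]-large : ∀ n → n + suc (suc n) ≤ 2 ^ suc n
  2^[1+n]-large n = begin
    n + suc (suc n)        ≡⟨ +-suc n (suc n) ⟩
    suc n + suc n          ≤⟨ +-mono-≤ (suc-≤-2^ n) (≤-trans (suc-≤-2^ n) (m≤m+n (2 ^ n) 0)) ⟩
    2 ^ suc n              ∎
    where open ≤-Reasoning

open BinaryWeight

module _ {c ℓ : Level} (R : CommutativeRing c ℓ) where
  open CommutativeRing R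
  open RawSemiringDefs (Semiring.rawSemiring semiring) using (_×_; _^_)
  open SetoidReasoning setoid
  open RingSolver commutativeSemiring using (solve; _:=_; _:+_; _:*_)

  private
    ∑ : ℕ → (ℕ → Carrier) → Carrier
    ∑ = sumBelow R

  ∑-cong : ∀ L {f g : ℕ → Carrier} → (∀ i → i ℕ.< L → f i ≈ g i) → ∑ L f ≈ ∑ L g
  ∑-cong zero    f≈g = refl
  ∑-cong (suc L) f≈g = +-cong (∑-cong L (λ i i<L → f≈g i (ℕP.m<n⇒m<1+n i<L))) (f≈g L ℕP.≤-refl)

  ∑-zero : ∀ L {f : ℕ → Carrier} → (∀ i → i ℕ.< L → f i ≈ 0#) → ∑ L f ≈ 0#
  ∑-zero L {f} f≈0 = trans (∑-cong L f≈0) (∑-const0 L)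
    where
      ∑-const0 : ∀ L → ∑ L (λ _ → 0#) ≈ 0#
      ∑-const0 zero    = refl
      ∑-const0 (suc L) = trans (+-identityʳ _) (∑-const0 L)

  ∑-+ : ∀ L (f g : ℕ → Carrier) → ∑ L (λ i → f i + g i) ≈ ∑ L f + ∑ L g
  ∑-+ zero    f g = sym (+-identityˡ 0#)
  ∑-+ (suc L) f g = trans (+-cong (∑-+ L f g) refl) (interchange _ _ _ _)
    where
      interchange : ∀ x y z w → (x + y) + (z + w) ≈ (x + z) + (y + w)
      interchange = solve 4 (λ x y z w → (x :+ y) :+ (z :+ w) := (x :+ z) :+ (y :+ w)) refl

  ∑-*ʳ : ∀ L (f : ℕ → Carrier) x → ∑ L f * x ≈ ∑ L (λ i → f i * x)
  ∑-*ʳ zero    f x = zeroˡ x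
  ∑-*ʳ (suc L) f x = trans (distribʳ x _ _) (+-cong (∑-*ʳ L f x) refl)

  ∑-swap : ∀ L K (F : ℕ → ℕ → Carrier) →
           ∑ L (λ i → ∑ K (λ N → F N i)) ≈ ∑ K (λ N → ∑ L (F N))
  ∑-swap L zero    F = ∑-zero L (λ _ _ → refl)
  ∑-swap L (suc K) F = trans (∑-+ L _ (F K)) (+-cong (∑-swap L K F) refl)

  ∑-split : ∀ B L (f : ℕ → Carrier) → ∑ (B ℕ.+ L) f ≈ ∑ B f + ∑ L (λ i → f (B ℕ.+ i))
  ∑-split B zero    f rewrite ℕP.+-identityʳ B = sym (+-identityʳ _)
  ∑-split B (suc L) f rewrite ℕP.+-suc B L =
    trans (+-cong (∑-split B L f) refl) (+-assoc _ _ _)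

  ∑-truncate : ∀ B L (f : ℕ → Carrier) → B ≤ L → (∀ i → B ≤ i → f i ≈ 0#) → ∑ L f ≈ ∑ B f
  ∑-truncate B L f B≤L f≈0 with ℕP.m≤n⇒∃[o]m+o≡n B≤L
  ... | L′ , Eq.refl = begin
    ∑ (B ℕ.+ L′) f                          ≈⟨ ∑-split B L′ f ⟩
    ∑ B f + ∑ L′ (λ i → f (B ℕ.+ i))        ≈⟨ +-cong refl (∑-zero L′ (λ i _ → f≈0 (B ℕ.+ i) (ℕP.m≤m+n B i))) ⟩
    ∑ B f + 0#                              ≈⟨ +-identityʳ _ ⟩
    ∑ B f                                   ∎

  ∑-single : ∀ L p (f : ℕ → Carrier) → p ℕ.< L → (∀ i → i ℕ.< L → i ≢ p → f i ≈ 0#) → ∑ L f ≈ f p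
  ∑-single (suc L) p f p<1+L others with p ℕ.≟ L
  ... | yes Eq.refl = trans (+-cong (∑-zero L (λ i i<L → others i (ℕP.m<n⇒m<1+n i<L) (ℕP.<⇒≢ i<L))) refl)
                            (+-identityˡ _)
  ... | no p≢L = trans (+-cong (∑-single L p f (ℕP.≤∧≢⇒< (ℕP.≤-pred p<1+L) p≢L)
                                 (λ i i<L → others i (ℕP.m<n⇒m<1+n i<L)))
                               (others L ℕP.≤-refl (λ L≡p → p≢L (Eq.sym L≡p))))
                       (+-identityʳ _)

  infix 4 _≐_
  _≐_ : Series R → Series R → Set ℓ
  f ≐ g = ∀ j → f j ≈ g j

  ∑ˢ : ℕ → (ℕ → Series R) → Series R
  ∑ˢ L F j = ∑ L (λ N → F N j)

  mon : Carrier → ℕ → Series R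
  mon b s j = if j ≡ᵇ s then b else 0#

  shift : ℕ → Series R → Series R
  shift zero    f j       = f j
  shift (suc s) f zero    = 0#
  shift (suc s) f (suc j) = shift s f j

  shift-below : ∀ s f j → j ℕ.< s → shift s f j ≡ 0#
  shift-below (suc s) f zero    _         = Eq.refl
  shift-below (suc s) f (suc j) (s≤s j<s) = shift-below s f j j<s

  shift-at : ∀ s f i → shift s f (s ℕ.+ i) ≡ f i
  shift-at zero    f i = Eq.refl
  shift-at (suc s) f i = shift-at s f i

  mon-at : ∀ b s → mon b s s ≡ b
  mon-at b s with s ≡ᵇ s in eq
  ... | true  = Eq.refl
  ... | false = ⊥-elim (Eq.subst T eq (ℕP.≡⇒≡ᵇ s s Eq.refl))

  mon-off : ∀ b s k → k ≢ s → mon b s k ≡ 0#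
  mon-off b s k k≢s with k ≡ᵇ s in eq
  ... | true  = ⊥-elim (k≢s (ℕP.≡ᵇ⇒≡ k s (Eq.subst T (Eq.sym eq) tt)))
  ... | false = Eq.refl

  ⊛-congˡ : ∀ {f g} h → f ≐ g → _⊛_ R f h ≐ _⊛_ R g h
  ⊛-congˡ h f≐g j = ∑-cong (suc j) (λ i _ → *-cong (f≐g i) refl)

  ⊛-distribˡ : ∀ f g h → _⊛_ R f (λ j → g j + h j) ≐ (λ j → _⊛_ R f g j + _⊛_ R f h j)
  ⊛-distribˡ f g h j = trans (∑-cong (suc j) (λ i _ → distribˡ (f i) _ _)) (∑-+ (suc j) _ _)

  ⊛-∑ˢ : ∀ L F g → _⊛_ R (∑ˢ L F) g ≐ ∑ˢ L (λ N → _⊛_ R (F N) g)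
  ⊛-∑ˢ L F g j = begin
    ∑ (suc j) (λ i → ∑ L (λ N → F N i) * g (j ∸ i))     ≈⟨ ∑-cong (suc j) (λ i _ → ∑-*ʳ L (λ N → F N i) (g (j ∸ i))) ⟩
    ∑ (suc j) (λ i → ∑ L (λ N → F N i * g (j ∸ i)))     ≈⟨ ∑-swap (suc j) L (λ N i → F N i * g (j ∸ i)) ⟩
    ∑ L (λ N → ∑ (suc j) (λ i → F N i * g (j ∸ i)))     ∎

  off-term : ∀ (f : Series R) b s j i → j ∸ i ≢ s → f i * mon b s (j ∸ i) ≈ 0#
  off-term f b s j i j∸i≢s = trans (*-cong refl (reflexive (mon-off b s (j ∸ i) j∸i≢s))) (zeroʳ (f i))

  ⊛-mon : ∀ f b s → _⊛_ R f (mon b s) ≐ (λ j → shift s f j * b)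
  ⊛-mon f b s j with s ℕ.≤? j
  ... | no s≰j = begin
    ∑ (suc j) (λ i → f i * mon b s (j ∸ i))  ≈⟨ ∑-zero (suc j) (λ i _ → off-term f b s j i (j∸i≢s i)) ⟩
    0#                                     ≈⟨ zeroˡ b ⟨
    0# * b                                 ≈⟨ *-cong (reflexive (shift-below s f j (ℕP.≰⇒> s≰j))) refl ⟨
    shift s f j * b                        ∎
    where
      j∸i≢s : ∀ i → j ∸ i ≢ s
      j∸i≢s i j∸i≡s = s≰j (Eq.subst (_≤ j) j∸i≡s (ℕP.m∸n≤m j i))
  ... | yes s≤j = begin
    ∑ (suc j) (λ i → f i * mon b s (j ∸ i))  ≈⟨ ∑-single (suc j) (j ∸ s) _ (s≤s (ℕP.m∸n≤m j s)) off ⟩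
    f (j ∸ s) * mon b s (j ∸ (j ∸ s))      ≡⟨ cong (λ k → f (j ∸ s) * mon b s k) (ℕP.m∸[m∸n]≡n s≤j) ⟩
    f (j ∸ s) * mon b s s                  ≡⟨ cong (f (j ∸ s) *_) (mon-at b s) ⟩
    f (j ∸ s) * b                          ≡⟨ cong (_* b) (shift-at s f (j ∸ s)) ⟨
    shift s f (s ℕ.+ (j ∸ s)) * b          ≡⟨ cong (λ k → shift s f k * b) (ℕP.m+[n∸m]≡n s≤j) ⟩
    shift s f j * b                        ∎
    where
      off : ∀ i → i ℕ.< suc j → i ≢ j ∸ s → f i * mon b s (j ∸ i) ≈ 0#
      off i i≤j i≢j∸s = off-term f b s j i
        (λ j∸i≡s → i≢j∸s (Eq.trans (Eq.sym (ℕP.m∸[m∸n]≡n (ℕP.≤-pred i≤j))) (cong (j ∸_) j∸i≡s)))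

  ⊛-oneS : ∀ f → _⊛_ R f (oneS R) ≐ f
  ⊛-oneS f j = begin
    _⊛_ R f (oneS R) j   ≈⟨ unit-as-mon ⟩
    _⊛_ R f (mon 1# 0) j ≈⟨ ⊛-mon f 1# 0 j ⟩
    f j * 1#             ≈⟨ *-identityʳ (f j) ⟩
    f j                  ∎
    where
      oneS-mon : ∀ k → oneS R k ≡ mon 1# 0 k
      oneS-mon zero    = Eq.refl
      oneS-mon (suc k) = Eq.refl
      unit-as-mon : _⊛_ R f (oneS R) j ≈ _⊛_ R f (mon 1# 0) j
      unit-as-mon = ∑-cong (suc j) (λ i _ → reflexive (cong (f i *_) (oneS-mon (j ∸ i))))

  module _ (γ δ : Carrier) where

    -- binomTerm w m = γ^m δ^(w-m) binom(w, m), the coefficient of x^(-m) in (δ + γ x⁻¹)^w.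
    -- The summands of the theorem are  term γ δ n m = binomTerm (wt (n + m)) m.
    binomTerm : ℕ → ℕ → Carrier
    binomTerm w m = γ ^ m * δ ^ (w ∸ m) * ((w C m) × 1#)

    binomTerm-vanish : ∀ w m → w ℕ.< m → binomTerm w m ≈ 0#
    binomTerm-vanish w m w<m =
      trans (*-cong refl (reflexive (cong (_× 1#) (k>n⇒nCk≡0 w<m)))) (zeroʳ _)

    -- Pascal's rule, (δ + γ x⁻¹)^(w+1) = δ (δ + γ x⁻¹)^w + γ x⁻¹ (δ + γ x⁻¹)^w, coefficientwise.
    pascal-zero : ∀ w → binomTerm (suc w) 0 ≈ δ * binomTerm w 0
    pascal-zero w = reassoc (γ ^ 0) δ (δ ^ w) ((w C 0) × 1#)
      where
        reassoc : ∀ g d e b → g * (d * e) * b ≈ d * (g * e * b)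
        reassoc = solve 4 (λ g d e b → g :* (d :* e) :* b := d :* (g :* e :* b)) refl

    pascal-suc : ∀ w m → binomTerm (suc w) (suc m) ≈ δ * binomTerm w (suc m) + γ * binomTerm w m
    pascal-suc w m = begin
      γ * γ ^ m * δ ^ (w ∸ m) * ((suc w C suc m) × 1#)
        ≡⟨ cong (λ k → γ * γ ^ m * δ ^ (w ∸ m) * (k × 1#)) (nCk+nC[k+1]≡[n+1]C[k+1] w m) ⟨
      γ * γ ^ m * δ ^ (w ∸ m) * ((w C m ℕ.+ w C suc m) × 1#)
        ≈⟨ *-cong refl (×-homo-+ 1# (w C m) (w C suc m)) ⟩
      γ * γ ^ m * δ ^ (w ∸ m) * (A + B)
        ≈⟨ split γ (γ ^ m) (δ ^ (w ∸ m)) A B ⟩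
      γ * γ ^ m * (δ ^ (w ∸ m) * B) + γ * (γ ^ m * δ ^ (w ∸ m) * A)
        ≈⟨ +-cong (*-cong refl lower-δ) refl ⟩
      γ * γ ^ m * (δ * δ ^ (w ∸ suc m) * B) + γ * (γ ^ m * δ ^ (w ∸ m) * A)
        ≈⟨ +-cong (pull-δ (γ * γ ^ m) δ (δ ^ (w ∸ suc m)) B) refl ⟩
      δ * (γ * γ ^ m * δ ^ (w ∸ suc m) * B) + γ * (γ ^ m * δ ^ (w ∸ m) * A) ∎
      where
        open SemiringMult semiring using (×-homo-+)
        A = (w C m) × 1#
        B = (w C suc m) × 1#
        split : ∀ g h e a b → g * h * e * (a + b) ≈ g * h * (e * b) + g * (h * e * a)
        split = solve 5 (λ g h e a b → g :* h :* e :* (a :+ b) := g :* h :* (e :* b) :+ g :* (h :* e :* a)) refl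
        pull-δ : ∀ g d e b → g * (d * e * b) ≈ d * (g * e * b)
        pull-δ = solve 4 (λ g d e b → g :* (d :* e :* b) := d :* (g :* e :* b)) refl
        -- binom(w, m+1) ≠ 0 forces m < w, and then w - m = (w - (m+1)) + 1
        lower-δ : δ ^ (w ∸ m) * B ≈ δ * δ ^ (w ∸ suc m) * B
        lower-δ with m ℕ.<? w
        ... | yes m<w = reflexive (cong (λ k → δ ^ k * B) (ℕP.+-∸-assoc 1 m<w))
        ... | no m≮w = trans (kill (δ ^ (w ∸ m))) (sym (kill (δ * δ ^ (w ∸ suc m))))
          where
            B≈0 : B ≈ 0#
            B≈0 = reflexive (cong (_× 1#) (k>n⇒nCk≡0 (s≤s (ℕP.≮⇒≥ m≮w))))
            kill : ∀ e → e * B ≈ 0#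
            kill e = trans (*-cong refl B≈0) (zeroʳ e)

    -- laurent w N is the power series x^N (δ + γ x⁻¹)^w with negative powers
    -- dropped: its coefficient of x^j is binomTerm w (N - j) for j ≤ N, else 0.
    laurent : ℕ → ℕ → Series R
    laurent w N       zero    = binomTerm w N
    laurent w zero    (suc j) = 0#
    laurent w (suc N) (suc j) = laurent w N j

    laurent-at : ∀ w j m → laurent w (j ℕ.+ m) j ≡ binomTerm w m
    laurent-at w zero    m = Eq.refl
    laurent-at w (suc j) m = laurent-at w j m

    laurent-above : ∀ w N j → N ℕ.< j → laurent w N j ≡ 0#
    laurent-above w zero    (suc j) _         = Eq.refl
    laurent-above w (suc N) (suc j) (s≤s N<j) = laurent-above w N j N<j

    laurent-pascal : ∀ w N → laurent (suc w) N ≐ (λ j → δ * laurent w N j + γ * laurent w N (suc j))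
    laurent-pascal w zero    zero    = trans (pascal-zero w) (sym (trans (+-cong refl (zeroʳ γ)) (+-identityʳ _)))
    laurent-pascal w (suc N) zero    = pascal-suc w N
    laurent-pascal w zero    (suc j) = sym (trans (+-cong (zeroʳ δ) (zeroʳ γ)) (+-identityʳ 0#))
    laurent-pascal w (suc N) (suc j) = laurent-pascal w N j

    -- If w ≤ N no negative powers were dropped, so raising N by s is a shift by s.
    laurent-shift : ∀ {w N} s → w ≤ N → laurent w (s ℕ.+ N) ≐ shift s (laurent w N)
    laurent-shift zero    w≤N j       = refl
    laurent-shift (suc s) w≤N zero    = binomTerm-vanish _ _ (s≤s (ℕP.≤-trans w≤N (ℕP.m≤n+m _ s)))
    laurent-shift (suc s) w≤N (suc j) = laurent-shift s w≤N j

    -- 1 + γ x^(s-1) + δ x^s;  the k-th factor of the product is  trinomial (2^k).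
    trinomial : ℕ → Series R
    trinomial s j = oneS R j + mon γ (s ∸ 1) j + mon δ s j

    -- Multiplying x^N (δ + γ x⁻¹)^w by  1 + x^s (δ + γ x⁻¹)  adds x^(s+N) (δ + γ x⁻¹)^(w+1).
    laurent-step : ∀ {w N} s → 1 ≤ s → w ≤ N →
                   _⊛_ R (laurent w N) (trinomial s) ≐ (λ j → laurent w N j + laurent (suc w) (s ℕ.+ N) j)
    laurent-step {w} {N} (suc p) _ w≤N j = begin
      _⊛_ R L (trinomial (suc p)) j
        ≈⟨ ⊛-distribˡ L (λ k → oneS R k + mon γ p k) (mon δ (suc p)) j ⟩
      _⊛_ R L (λ k → oneS R k + mon γ p k) j + _⊛_ R L (mon δ (suc p)) j
        ≈⟨ +-cong (⊛-distribˡ L (oneS R) (mon γ p) j) refl ⟩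
      _⊛_ R L (oneS R) j + _⊛_ R L (mon γ p) j + _⊛_ R L (mon δ (suc p)) j
        ≈⟨ +-cong (+-cong (⊛-oneS L j) (⊛-mon L γ p j)) (⊛-mon L δ (suc p) j) ⟩
      L j + shift p L j * γ + shift (suc p) L j * δ
        ≈⟨ regroup (L j) (shift p L j) (shift (suc p) L j) γ δ ⟩
      L j + (δ * shift (suc p) L j + γ * shift p L j)
        ≈⟨ +-cong refl (+-cong (*-cong refl (laurent-shift (suc p) w≤N j)) (*-cong refl (laurent-shift p w≤N j))) ⟨
      L j + (δ * laurent w (suc p ℕ.+ N) j + γ * laurent w (suc p ℕ.+ N) (suc j))
        ≈⟨ +-cong refl (laurent-pascal w (suc p ℕ.+ N) j) ⟨
      L j + laurent (suc w) (suc p ℕ.+ N) j ∎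
      where
        L = laurent w N
        regroup : ∀ l u v g d → l + u * g + v * d ≈ l + (d * v + g * u)
        regroup = solve 5 (λ l u v g d → l :+ u :* g :+ v :* d := l :+ (d :* v :+ g :* u)) refl

    -- The product of the summands x^(2^k) (δ + γ x⁻¹) over the binary digits k
    -- of N, namely x^N (δ + γ x⁻¹)^wt(N).
    monomial : ℕ → Series R
    monomial N = laurent (wt N) N

    monomial-step : ∀ K N → N ℕ.< 2 ℕ.^ K →
                    _⊛_ R (monomial N) (factor R γ δ K) ≐ (λ j → monomial N j + monomial (2 ℕ.^ K ℕ.+ N) j)
    monomial-step K N N<2^K j = begin
      _⊛_ R (monomial N) (trinomial (2 ℕ.^ K)) j
        ≈⟨ laurent-step (2 ℕ.^ K) (ℕP.m^n>0 2 K) (wt-≤ N) j ⟩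
      monomial N j + laurent (suc (wt N)) (2 ℕ.^ K ℕ.+ N) j
        ≡⟨ cong (λ w → monomial N j + laurent w (2 ℕ.^ K ℕ.+ N) j) (wt-2^K+ K N N<2^K) ⟨
      monomial N j + monomial (2 ℕ.^ K ℕ.+ N) j ∎

    expansion : ∀ K → partialProd R γ δ K ≐ ∑ˢ (2 ℕ.^ K) monomial
    expansion zero    zero    = sym (trans (+-identityˡ _) (trans (*-cong (*-identityˡ 1#) (+-identityʳ 1#)) (*-identityˡ 1#)))
    expansion zero    (suc j) = sym (+-identityˡ 0#)
    expansion (suc K) j = begin
      _⊛_ R (partialProd R γ δ K) (factor R γ δ K) j
        ≈⟨ ⊛-congˡ (factor R γ δ K) (expansion K) j ⟩
      _⊛_ R (∑ˢ 2^K monomial) (factor R γ δ K) j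
        ≈⟨ ⊛-∑ˢ 2^K monomial (factor R γ δ K) j ⟩
      ∑ 2^K (λ N → _⊛_ R (monomial N) (factor R γ δ K) j)
        ≈⟨ ∑-cong 2^K (λ N N<2^K → monomial-step K N N<2^K j) ⟩
      ∑ 2^K (λ N → monomial N j + monomial (2^K ℕ.+ N) j)
        ≈⟨ ∑-+ 2^K (λ N → monomial N j) (λ N → monomial (2^K ℕ.+ N) j) ⟩
      ∑ 2^K (λ N → monomial N j) + ∑ 2^K (λ N → monomial (2^K ℕ.+ N) j)
        ≈⟨ ∑-split 2^K 2^K (λ N → monomial N j) ⟨
      ∑ (2^K ℕ.+ 2^K) (λ N → monomial N j)
        ≡⟨ cong (λ L → ∑ (2^K ℕ.+ L) (λ N → monomial N j)) (ℕP.+-identityʳ 2^K) ⟨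
      ∑ˢ (2 ℕ.^ suc K) monomial j ∎
      where 2^K = 2 ℕ.^ K

    term-tail : ∀ n L → suc (suc n) ≤ L → ∑ L (term R γ δ n) ≈ ∑ (suc (suc n)) (term R γ δ n)
    term-tail n L n+2≤L = ∑-truncate (suc (suc n)) L (term R γ δ n) n+2≤L
      (λ m n+2≤m → binomTerm-vanish (wt (n ℕ.+ m)) m (wt-small n m n+2≤m))

    coefficient : ∀ n B → n ℕ.+ suc (suc n) ≤ B →
                  ∑ˢ B monomial n ≈ ∑ (suc (suc n)) (term R γ δ n)
    coefficient n B large with ℕP.m≤n⇒∃[o]m+o≡n (ℕP.≤-trans (ℕP.m≤m+n n (suc (suc n))) large)
    ... | L , Eq.refl = begin
      ∑ (n ℕ.+ L) (λ N → monomial N n)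
        ≈⟨ ∑-split n L (λ N → monomial N n) ⟩
      ∑ n (λ N → monomial N n) + ∑ L (λ m → monomial (n ℕ.+ m) n)
        ≈⟨ +-cong (∑-zero n (λ N N<n → reflexive (laurent-above (wt N) N n N<n)))
                  (∑-cong L (λ m _ → reflexive (laurent-at (wt (n ℕ.+ m)) n m))) ⟩
      0# + ∑ L (term R γ δ n)
        ≈⟨ +-identityˡ _ ⟩
      ∑ L (term R γ δ n)
        ≈⟨ term-tail n L (ℕP.+-cancelˡ-≤ n _ _ large) ⟩
      ∑ (suc (suc n)) (term R γ δ n) ∎

-- The vocabulary of the statement; it is opened only here because above the
-- ring operations _+_ and _≈_ are used unqualified.
open import Data.Nat using (_<_; _+_)
open CommutativeRing using (Carrier; _≈_)

theorem8 : {c ℓ : Level} (R : CommutativeRing c ℓ) →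
    (γ δ : Carrier R) (n M : ℕ) → n + 1 < M →
    _≈_ R (a R γ δ n) (sumBelow R M (term R γ δ n))
theorem8 R γ δ n M n+1<M = begin
  a R γ δ n                                 ≈⟨ expansion R γ δ (suc n) n ⟩
  ∑ˢ R (2 ℕ.^ suc n) (monomial R γ δ) n     ≈⟨ coefficient R γ δ n (2 ℕ.^ suc n) (2^[1+n]-large n) ⟩
  sumBelow R (suc (suc n)) (term R γ δ n)   ≈⟨ term-tail R γ δ n M n+2≤M ⟨
  sumBelow R M (term R γ δ n)               ∎
  where
    open SetoidReasoning (CommutativeRing.setoid R)
    n+2≤M : suc (suc n) ≤ M
    n+2≤M = Eq.subst (λ k → suc k ≤ M) (ℕP.+-comm n 1) n+1<M
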